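{- Let $n$ be an even integer and $\mathbf g$ a finite simple graph on $n$ vertices. Then $\Psi_{\bullet-\bullet}(\mathbf g)=\sum_{\pi}X_{\mathbf g_{\downarrow\pi}}(\mathbf x^2),$ where the sum is over all perfect matchings $\pi$ of $\mathbf g$.
   Context: Let $V$ be the vertex set of $\mathbf g$. For a composition $a=(a_1,\dots,a_\ell)$ of $n$, let $c_a(\mathbf g)$ be the number of ordered set partitions $(B_1,\dots,B_\ell)$ of $V$ with $|B_i|=a_i$ such that each induced subgraph $\mathbf g|_{B_i}$ is a perfect matching (a disjoint union of edges covering $B_i$, with no further edges). Define $\Psi_{\bullet-\bullet}(\mathbf g)=\sum_{a\models n}c_a(\mathbf g)M_a$, with $M_a=\sum_{i_1<\dots<i_\ell}x_{i_1}^{a_1}\cdots x_{i_\ell}^{a_\ell}$. (This is the image of $\mathbf g$ under the canonical Hopf morphism to $QSym$ associated with the character on the Hopf algebra of isomorphism classes of graphs that is $1$ on the single edge and $0$ on all other connected graphs.) For a perfect matching $\pi$ of $\mathbf g$, $\mathbf g_{\downarrow\pi}$ is the simple graph whose vertices are the edges of $\pi$, two adjacent iff some edge of $\mathbf g$ joins them. $X_{\mathbf h}=\sum_\kappa\prod_v x_{\kappa(v)}$ is the chromatic symmetric function (sum over proper colorings of $\mathbf h$ by positive integers), and $F(\mathbf x^2)$ is $F$ with each $x_i$ replaced by $x_i^2$. -}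

module Defs where

open import Data.Nat using (ℕ; zero; suc; _+_; _*_; _≡ᵇ_; _<ᵇ_)
import Data.Nat as ℕ
open import Data.Bool using (Bool; true; false; not; _∧_; _∨_; if_then_else_)
open import Data.Fin using (Fin; toℕ)
import Data.Fin as Fin
open import Data.List.Base using (List; []; _∷_; length; filterᵇ; map; concatMap; lookup; allFin)
open import Data.Nat.ListAction using (sum)
open import Data.Bool.ListAction using (and)
open import Data.List.Properties using (≡-dec)
open import Relation.Nullary.Decidable using (⌊_⌋)
open import Relation.Binary.PropositionalEquality using (_≡_)

record Graph (n : ℕ) : Set where
  field
    adj    : Fin n → Fin n → Bool
    sym    : ∀ u v → adj u v ≡ adj v u
    irrefl : ∀ v → adj v v ≡ false
open Graph public

_==ᶠ_ : ∀ {k} → Fin k → Fin k → Bool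
i ==ᶠ j = ⌊ i Fin.≟ j ⌋

consF : ∀ {n k} → Fin k → (Fin n → Fin k) → Fin (suc n) → Fin k
consF c f Fin.zero    = c
consF c f (Fin.suc i) = f i

allFuns : ∀ n k → List (Fin n → Fin k)
allFuns zero    k = (λ ()) ∷ []
allFuns (suc n) k = concatMap (λ f → map (λ c → consF c f) (allFin k)) (allFuns n k)

allᵇ : ∀ {A : Set} → (A → Bool) → List A → Bool
allᵇ p xs = and (map p xs)

count : ∀ {A : Set} → (A → Bool) → List A → ℕ
count p xs = length (filterᵇ p xs)

fiber : ∀ {n k} → (Fin n → Fin k) → Fin k → ℕ
fiber {n} f i = count (λ v → f v ==ᶠ i) (allFin n)

-- Compositions of n (lists of positive integers summing to n), each once.
-- Compositions of n+2 arise from those of n+1 by prepending a part 1 or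
-- increasing the first part by one.

bump : List ℕ → List ℕ
bump []       = []
bump (x ∷ xs) = suc x ∷ xs

compositions : ℕ → List (List ℕ)
compositions zero          = [] ∷ []
compositions (suc zero)    = (1 ∷ []) ∷ []
compositions (suc (suc n)) =
  concatMap (λ c → (1 ∷ c) ∷ bump c ∷ []) (compositions (suc n))

-- Formal power series in x₁, x₂, … with ℕ coefficients are represented
-- by their coefficient functions: a monomial x₁^α₁ ⋯ x_k^α_k is given by
-- the list α = (α₁,…,α_k) (trailing zeros are harmless).

-- coefficient of x^α in the monomial quasisymmetric function M_a:
-- 1 iff the nonzero entries of α, in order, are exactly a.
Mcoeff : List ℕ → List ℕ → ℕ
Mcoeff a α =
  if ⌊ ≡-dec ℕ._≟_ (filterᵇ (λ x → not (x ≡ᵇ 0)) α) a ⌋ then 1 else 0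

-- c_a(g): ordered set partitions (B₁,…,B_ℓ) of V with |Bᵢ| = aᵢ, encoded
-- as block-assignment functions f : Fin n → Fin ℓ (Bᵢ = f⁻¹(i)), such that
-- every induced subgraph g|_{Bᵢ} is a perfect matching, i.e. every vertex
-- v has exactly one neighbour w in its own block.

isBlockAssignment : ∀ {n} → (a : List ℕ) → (Fin n → Fin (length a)) → Bool
isBlockAssignment a f = allᵇ (λ i → fiber f i ≡ᵇ lookup a i) (allFin (length a))

inducesMatchings : ∀ {n ℓ} → Graph n → (Fin n → Fin ℓ) → Bool
inducesMatchings {n} g f =
  allᵇ (λ v → count (λ w → (f w ==ᶠ f v) ∧ adj g v w) (allFin n) ≡ᵇ 1) (allFin n)

c : ∀ {n} → List ℕ → Graph n → ℕ
c {n} a g = count (λ f → isBlockAssignment a f ∧ inducesMatchings g f)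
                  (allFuns n (length a))

-- coefficient of x^α in Ψ_{•-•}(g) = Σ_{a ⊨ n} c_a(g) M_a
Ψcoeff : ∀ {n} → Graph n → List ℕ → ℕ
Ψcoeff {n} g α = sum (map (λ a → c a g * Mcoeff a α) (compositions n))

-- Perfect matchings of g, encoded as their partner map π : V → V
-- (a fixed-point-free involution with v ~ π v for every v).

isPerfectMatching : ∀ {n} → Graph n → (Fin n → Fin n) → Bool
isPerfectMatching {n} g π =
  allᵇ (λ v → (π (π v) ==ᶠ v) ∧ not (π v ==ᶠ v) ∧ adj g v (π v)) (allFin n)

perfectMatchings : ∀ {n} → Graph n → List (Fin n → Fin n)
perfectMatchings {n} g = filterᵇ (isPerfectMatching g) (allFuns n n)

edgeReps : ∀ {n} → (Fin n → Fin n) → List (Fin n)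
edgeReps {n} π = filterᵇ (λ v → toℕ v <ᵇ toℕ (π v)) (allFin n)

-- g↓π : vertex set Fin m (m = number of edges of π), vertex i standing for
-- the π-edge {rᵢ, π rᵢ}; distinct i, j adjacent iff some edge of g joins
-- the two π-edges.
downSize : ∀ {n} → (Fin n → Fin n) → ℕ
downSize π = length (edgeReps π)

downAdj : ∀ {n} → Graph n → (π : Fin n → Fin n) →
          Fin (downSize π) → Fin (downSize π) → Bool
downAdj g π i j =
  not (i ==ᶠ j) ∧
  ((adj g r s ∨ adj g r (π s)) ∨ (adj g (π r) s ∨ adj g (π r) (π s)))
  where
    r = lookup (edgeReps π) i
    s = lookup (edgeReps π) j

-- Coefficient of x^α in X_h(x²) for a graph h on Fin m with adjacency
-- hadj: the number of proper colourings κ with ∏_v x_{κ(v)}² = x^α.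
-- Such κ use only colours 1,…,k (k = length α), so κ : Fin m → Fin k,
-- and the condition is 2·|κ⁻¹(i)| = αᵢ for all i.

isProper : ∀ {m k} → (Fin m → Fin m → Bool) → (Fin m → Fin k) → Bool
isProper {m} hadj κ =
  allᵇ (λ u → allᵇ (λ v → not (hadj u v ∧ (κ u ==ᶠ κ v))) (allFin m)) (allFin m)

XsqCoeff : ∀ m → (Fin m → Fin m → Bool) → List ℕ → ℕ
XsqCoeff m hadj α =
  count (λ κ → isProper hadj κ ∧
               allᵇ (λ i → 2 * fiber κ i ≡ᵇ lookup α i) (allFin (length α)))
        (allFuns m (length α))

matchingSideCoeff : ∀ {n} → Graph n → List ℕ → ℕ
matchingSideCoeff g α =
  sum (map (λ π → XsqCoeff (downSize π) (downAdj g π) α) (perfectMatchings g))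

module Submission where

-- Both sides count the block assignments h : V → {1,…,ℓ} with block sizes α whose blocks
-- induce perfect matchings. On the left, M_a contributes to x^α only for a = α with its zeros
-- removed, and empty blocks do not change the count. On the right, a proper colouring κ of
-- g↓π with colour classes of sizes α/2 lifts to the assignment v ↦ κ (π-edge of v), and these
-- lifts are exactly the assignments whose blocks induce the matching π. An assignment whose
-- blocks induce perfect matchings induces exactly one π, so summing over π counts it once.

open import Defs hiding (sym)

import Data.Bool as Bool
open import Data.Bool using (Bool; true; false; not; _∧_; _∨_; if_then_else_)
open import Data.Bool.ListAction using (and)
open import Data.Bool.Properties using (∧-zeroʳ; ∨-zeroʳ; not-injective; ¬-not; not-¬; T-≡)
open import Data.Empty using (⊥-elim)
open import Data.Fin using (Fin; toℕ)
import Data.Fin as Fin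
open import Data.Fin.Properties using (suc-injective; toℕ-injective; any?)
open import Data.List.Base
  using (List; []; _∷_; length; lookup; map; filterᵇ; concatMap; allFin; tabulate; _++_)
open import Data.List.Membership.Propositional using (_∈_)
open import Data.List.Membership.Propositional.Properties using (∈-filter⁺; ∈-filter⁻; ∈-allFin; ∈-lookup)
open import Data.List.Properties using (map-tabulate; ++-assoc; ≡-dec)
import Data.List.Relation.Unary.All as All
open import Data.List.Relation.Unary.AllPairs using (_∷_)
open import Data.List.Relation.Unary.Any using (here; there; index)
open import Data.List.Relation.Unary.Any.Properties using (lookup-index)
open import Data.List.Relation.Unary.Unique.Propositional using (Unique)
import Data.List.Relation.Unary.Unique.Propositional.Properties as Unique
import Data.Nat as ℕ
open import Data.Nat using (ℕ; zero; suc; _+_; _*_; _≡ᵇ_; _<ᵇ_; _<_)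
open import Data.Nat.Divisibility using (_∣_)
open import Data.Nat.ListAction using (sum)
open import Data.Nat.Properties
  using ( +-*-semiring; +-commutativeSemigroup; +-identityʳ; +-assoc; *-identityˡ; *-identityʳ
        ; *-zeroʳ; *-distribˡ-+; ≡ᵇ⇒≡; ≡⇒≡ᵇ; <ᵇ⇒<; <⇒<ᵇ; <-asym; ≤∧≢⇒<; ≮⇒≥)
open import Data.Product using (_×_; _,_; ∃-syntax; proj₁; proj₂; curry)
open import Data.Sum using (_⊎_; inj₁; inj₂)
open import Function using (id; _∘_; flip; Injective)
open import Function.Bundles using (Equivalence)
open import Relation.Nullary using (yes; no)
open import Relation.Nullary.Decidable using (Dec; ⌊_⌋; ⌊⌋-map′; toWitness; fromWitness; T?)
open import Relation.Binary.PropositionalEquality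
  using (_≡_; _≢_; _≗_; refl; sym; trans; cong; cong₂; subst; subst₂; module ≡-Reasoning)

open import Algebra.Properties.CommutativeSemigroup +-commutativeSemigroup
  using () renaming (interchange to +-interchange)
open import Algebra.Properties.Semiring.Sum +-*-semiring
  using (sum-syntax; sum-cong-≗; sum-replicate-zero; ∑-distrib-+; ∑-comm; *-distribˡ-sum; *-distribʳ-sum)

open ≡-Reasoning

[_] : Bool → ℕ
[ b ] = if b then 1 else 0

[∧] : ∀ a b → [ a ∧ b ] ≡ [ a ] * [ b ]
[∧] true  b = sym (*-identityˡ [ b ])
[∧] false b = refl

bool-ext : ∀ {a b} → (a ≡ true → b ≡ true) → (b ≡ true → a ≡ true) → a ≡ b
bool-ext {true}  {true}  _ _ = refl
bool-ext {true}  {false} f _ = sym (f refl)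
bool-ext {false} {true}  _ g = g refl
bool-ext {false} {false} _ _ = refl

∧-true⁻ˡ : ∀ {a b} → a ∧ b ≡ true → a ≡ true
∧-true⁻ˡ {true} _ = refl

∧-true⁻ʳ : ∀ {a b} → a ∧ b ≡ true → b ≡ true
∧-true⁻ʳ {true} e = e

∨-true⁺ˡ : ∀ {a} b → a ≡ true → a ∨ b ≡ true
∨-true⁺ˡ b refl = refl

∨-true⁺ʳ : ∀ a {b} → b ≡ true → a ∨ b ≡ true
∨-true⁺ʳ a refl = ∨-zeroʳ a

∨-true⁻ : ∀ {a b} → a ∨ b ≡ true → a ≡ true ⊎ b ≡ true
∨-true⁻ {true}  _ = inj₁ refl
∨-true⁻ {false} e = inj₂ e

≡ᵇ-true⇒≡ : ∀ {m n} → (m ≡ᵇ n) ≡ true → m ≡ n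
≡ᵇ-true⇒≡ {m} {n} = ≡ᵇ⇒≡ m n ∘ Equivalence.from T-≡

≡⇒≡ᵇ-true : ∀ {m n} → m ≡ n → (m ≡ᵇ n) ≡ true
≡⇒≡ᵇ-true {m} {n} = Equivalence.to T-≡ ∘ ≡⇒≡ᵇ m n

<ᵇ-true⇒< : ∀ {m n} → (m <ᵇ n) ≡ true → m < n
<ᵇ-true⇒< {m} {n} = <ᵇ⇒< m n ∘ Equivalence.from T-≡

<⇒<ᵇ-true : ∀ {m n} → m < n → (m <ᵇ n) ≡ true
<⇒<ᵇ-true = Equivalence.to T-≡ ∘ <⇒<ᵇ

⌊⌋-true⇒ : ∀ {P : Set} {d : Dec P} → ⌊ d ⌋ ≡ true → P
⌊⌋-true⇒ = toWitness ∘ Equivalence.from T-≡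

⇒⌊⌋-true : ∀ {P : Set} {d : Dec P} → P → ⌊ d ⌋ ≡ true
⇒⌊⌋-true = Equivalence.to T-≡ ∘ fromWitness

==ᶠ⇒≡ : ∀ {k} {i j : Fin k} → (i ==ᶠ j) ≡ true → i ≡ j
==ᶠ⇒≡ = ⌊⌋-true⇒

≡⇒==ᶠ : ∀ {k} {i j : Fin k} → i ≡ j → (i ==ᶠ j) ≡ true
≡⇒==ᶠ = ⇒⌊⌋-true

≢⇒==ᶠ : ∀ {k} {i j : Fin k} → i ≢ j → (i ==ᶠ j) ≡ false
≢⇒==ᶠ i≢j = ¬-not (i≢j ∘ ==ᶠ⇒≡)

==ᶠ-injective : ∀ {k k′} {e : Fin k′ → Fin k} → Injective _≡_ _≡_ e →
                ∀ i j → (e i ==ᶠ e j) ≡ (i ==ᶠ j)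
==ᶠ-injective inj i j = bool-ext (≡⇒==ᶠ ∘ inj ∘ ==ᶠ⇒≡) (≡⇒==ᶠ ∘ cong _ ∘ ==ᶠ⇒≡)

suc-==ᶠ : ∀ {k} (i j : Fin k) → (Fin.suc i ==ᶠ Fin.suc j) ≡ (i ==ᶠ j)
suc-==ᶠ i j = ⌊⌋-map′ _ _ (i Fin.≟ j)

private
  variable
    A B : Set

∑ˡ : List A → (A → ℕ) → ℕ
∑ˡ xs f = sum (map f xs)

infixl 10 ∑ˡ
syntax ∑ˡ xs (λ x → e) = ∑[ x ∈ xs ] e

∑ˡ-cong : ∀ (xs : List A) {f g : A → ℕ} → f ≗ g → ∑ˡ xs f ≡ ∑ˡ xs g
∑ˡ-cong []       _   = refl
∑ˡ-cong (x ∷ xs) f≗g = cong₂ _+_ (f≗g x) (∑ˡ-cong xs f≗g)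

∑ˡ-zero : ∀ (xs : List A) → ∑[ x ∈ xs ] 0 ≡ 0
∑ˡ-zero []       = refl
∑ˡ-zero (_ ∷ xs) = ∑ˡ-zero xs

∑ˡ-distrib-+ : ∀ (xs : List A) (f g : A → ℕ) →
               ∑[ x ∈ xs ] (f x + g x) ≡ ∑ˡ xs f + ∑ˡ xs g
∑ˡ-distrib-+ []       f g = refl
∑ˡ-distrib-+ (x ∷ xs) f g = begin
  f x + g x + ∑[ y ∈ xs ] (f y + g y)   ≡⟨ cong (f x + g x +_) (∑ˡ-distrib-+ xs f g) ⟩
  f x + g x + (∑ˡ xs f + ∑ˡ xs g)       ≡⟨ +-interchange (f x) (g x) _ _ ⟩
  f x + ∑ˡ xs f + (g x + ∑ˡ xs g)       ∎

*-distribˡ-∑ˡ : ∀ (xs : List A) c (f : A → ℕ) → c * ∑ˡ xs f ≡ ∑[ x ∈ xs ] (c * f x)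
*-distribˡ-∑ˡ []       c f = *-zeroʳ c
*-distribˡ-∑ˡ (x ∷ xs) c f =
  trans (*-distribˡ-+ c (f x) (∑ˡ xs f)) (cong (c * f x +_) (*-distribˡ-∑ˡ xs c f))

∑ˡ-comm : ∀ (xs : List A) (ys : List B) (f : A → B → ℕ) →
          ∑[ x ∈ xs ] ∑ˡ ys (f x) ≡ ∑[ y ∈ ys ] ∑[ x ∈ xs ] f x y
∑ˡ-comm []       ys f = sym (∑ˡ-zero ys)
∑ˡ-comm (x ∷ xs) ys f =
  trans (cong (∑ˡ ys (f x) +_) (∑ˡ-comm xs ys f)) (sym (∑ˡ-distrib-+ ys (f x) _))

∑ˡ-++ : ∀ (xs ys : List A) (f : A → ℕ) → ∑ˡ (xs ++ ys) f ≡ ∑ˡ xs f + ∑ˡ ys f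
∑ˡ-++ []       ys f = refl
∑ˡ-++ (x ∷ xs) ys f = trans (cong (f x +_) (∑ˡ-++ xs ys f)) (sym (+-assoc (f x) _ _))

∑ˡ-concatMap : ∀ (h : A → List B) (xs : List A) (f : B → ℕ) →
               ∑ˡ (concatMap h xs) f ≡ ∑[ x ∈ xs ] ∑ˡ (h x) f
∑ˡ-concatMap h []       f = refl
∑ˡ-concatMap h (x ∷ xs) f =
  trans (∑ˡ-++ (h x) (concatMap h xs) f) (cong (∑ˡ (h x) f +_) (∑ˡ-concatMap h xs f))

∑ˡ-map : ∀ (h : A → B) (xs : List A) (f : B → ℕ) →
         ∑ˡ (map h xs) f ≡ ∑[ x ∈ xs ] f (h x)
∑ˡ-map h []       f = refl
∑ˡ-map h (x ∷ xs) f = cong (f (h x) +_) (∑ˡ-map h xs f)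

∑ˡ-filterᵇ : ∀ (p : A → Bool) (xs : List A) (f : A → ℕ) →
             ∑ˡ (filterᵇ p xs) f ≡ ∑[ x ∈ xs ] ([ p x ] * f x)
∑ˡ-filterᵇ p []       f = refl
∑ˡ-filterᵇ p (x ∷ xs) f with p x
... | true  = cong₂ _+_ (sym (+-identityʳ (f x))) (∑ˡ-filterᵇ p xs f)
... | false = ∑ˡ-filterᵇ p xs f

count≡∑ˡ : ∀ (p : A → Bool) (xs : List A) → count p xs ≡ ∑[ x ∈ xs ] [ p x ]
count≡∑ˡ p []       = refl
count≡∑ˡ p (x ∷ xs) with p x
... | true  = cong suc (count≡∑ˡ p xs)
... | false = count≡∑ˡ p xs

∑ˡ-tabulate : ∀ n (g : Fin n → A) (f : A → ℕ) →
              ∑ˡ (tabulate g) f ≡ ∑[ i < n ] f (g i)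
∑ˡ-tabulate zero    g f = refl
∑ˡ-tabulate (suc n) g f = cong (f (g Fin.zero) +_) (∑ˡ-tabulate n (g ∘ Fin.suc) f)

∑ˡ-allFin : ∀ n (f : Fin n → ℕ) → ∑ˡ (allFin n) f ≡ ∑[ i < n ] f i
∑ˡ-allFin n = ∑ˡ-tabulate n id

count-allFin : ∀ {n} (p : Fin n → Bool) → count p (allFin n) ≡ ∑[ i < n ] [ p i ]
count-allFin {n} p = trans (count≡∑ˡ p (allFin n)) (∑ˡ-allFin n _)

count-cong : ∀ (xs : List A) {p q : A → Bool} → p ≗ q → count p xs ≡ count q xs
count-cong xs {p} {q} p≗q = begin
  count p xs            ≡⟨ count≡∑ˡ p xs ⟩
  ∑[ x ∈ xs ] [ p x ]   ≡⟨ ∑ˡ-cong xs (cong [_] ∘ p≗q) ⟩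
  ∑[ x ∈ xs ] [ q x ]   ≡⟨ count≡∑ˡ q xs ⟨
  count q xs            ∎

count-none : ∀ (xs : List A) {p : A → Bool} → (∀ x → p x ≡ false) → count p xs ≡ 0
count-none []       _    = refl
count-none (x ∷ xs) none rewrite none x = count-none xs none

count-positive : ∀ {xs : List A} {x} (p : A → Bool) → x ∈ xs → p x ≡ true → count p xs ≢ 0
count-positive {xs = y ∷ ys} p (here refl) px rewrite px = λ ()
count-positive {xs = y ∷ ys} p (there x∈ys) px with p y
... | true  = λ ()
... | false = count-positive p x∈ys px

count-witness : ∀ (xs : List A) (p : A → Bool) → count p xs ≢ 0 → ∃[ x ] p x ≡ true
count-witness []       p c≢0 = ⊥-elim (c≢0 refl)
count-witness (x ∷ xs) p c≢0 with p x in px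
... | true  = x , px
... | false = count-witness xs p c≢0

count≡1⇒unique : ∀ {xs : List A} {x y} (p : A → Bool) → count p xs ≡ 1 →
                 x ∈ xs → p x ≡ true → y ∈ xs → p y ≡ true → x ≡ y
count≡1⇒unique {xs = xs} {x} {y} p c≡1 x∈xs px y∈xs py =
  singleton (filterᵇ p xs) c≡1 (∈-filter⁺ (T? ∘ p) x∈xs (Equivalence.from T-≡ px))
                               (∈-filter⁺ (T? ∘ p) y∈xs (Equivalence.from T-≡ py))
  where
  singleton : ∀ zs → length zs ≡ 1 → x ∈ zs → y ∈ zs → x ≡ y
  singleton (_ ∷ []) _ (here refl) (here refl) = refl

count-*-implied : ∀ (xs : List A) (p : A → Bool) {b} → (∀ x → p x ≡ true → b ≡ true) →
                  count p xs * [ b ] ≡ count p xs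
count-*-implied xs p {true}  _   = *-identityʳ (count p xs)
count-*-implied xs p {false} p⇒b =
  trans (*-zeroʳ (count p xs)) (sym (count-none xs (λ x → ¬-not ((λ ()) ∘ p⇒b x))))

double-count : ∀ (xs : List A) (ys : List B) {P : A → Bool} {Q : B → Bool} (R : A → B → Bool) →
               (∀ x → count (R x) ys ≡ [ P x ]) → (∀ y → count (flip R y) xs ≡ [ Q y ]) →
               count P xs ≡ count Q ys
double-count xs ys {P} {Q} R rows cols = begin
  count P xs
    ≡⟨ count≡∑ˡ P xs ⟩
  ∑[ x ∈ xs ] [ P x ]
    ≡⟨ ∑ˡ-cong xs (λ x → trans (sym (rows x)) (count≡∑ˡ (R x) ys)) ⟩
  ∑[ x ∈ xs ] ∑[ y ∈ ys ] [ R x y ]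
    ≡⟨ ∑ˡ-comm xs ys (λ x y → [ R x y ]) ⟩
  ∑[ y ∈ ys ] ∑[ x ∈ xs ] [ R x y ]
    ≡⟨ ∑ˡ-cong ys (λ y → trans (sym (count≡∑ˡ (flip R y) xs)) (cols y)) ⟩
  ∑[ y ∈ ys ] [ Q y ]
    ≡⟨ count≡∑ˡ Q ys ⟨
  count Q ys ∎

lookup-injective : ∀ {xs : List A} → Unique xs → Injective _≡_ _≡_ (lookup xs)
lookup-injective (_  ∷ _) {Fin.zero}  {Fin.zero}  _  = refl
lookup-injective (x≢ ∷ _) {Fin.zero}  {Fin.suc j} eq = ⊥-elim (All.lookup x≢ (∈-lookup j) eq)
lookup-injective (x≢ ∷ _) {Fin.suc i} {Fin.zero}  eq = ⊥-elim (All.lookup x≢ (∈-lookup i) (sym eq))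
lookup-injective (_  ∷ u) {Fin.suc i} {Fin.suc j} eq = cong Fin.suc (lookup-injective u eq)

∑-select : ∀ n (a : Fin n) (f : Fin n → ℕ) → ∑[ i < n ] ([ a ==ᶠ i ] * f i) ≡ f a
∑-select (suc n) Fin.zero f =
  trans (cong₂ _+_ (+-identityʳ (f Fin.zero)) (sum-replicate-zero n)) (+-identityʳ (f Fin.zero))
∑-select (suc n) (Fin.suc a) f = begin
  ∑[ i < n ] ([ Fin.suc a ==ᶠ Fin.suc i ] * f (Fin.suc i))
    ≡⟨ sum-cong-≗ (λ i → cong (λ b → [ b ] * f (Fin.suc i)) (suc-==ᶠ a i)) ⟩
  ∑[ i < n ] ([ a ==ᶠ i ] * f (Fin.suc i))
    ≡⟨ ∑-select n a (f ∘ Fin.suc) ⟩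
  f (Fin.suc a) ∎

∑-δ : ∀ n (a : Fin n) → ∑[ i < n ] [ a ==ᶠ i ] ≡ 1
∑-δ n a = trans (sum-cong-≗ {n} (λ i → sym (*-identityʳ _))) (∑-select n a (λ _ → 1))

allᵇ-allFin⁻ : ∀ {n} {p : Fin n → Bool} → allᵇ p (allFin n) ≡ true → ∀ i → p i ≡ true
allᵇ-allFin⁻ {n} {p} all-p i = go n id all-p i
  where
  go : ∀ m (g : Fin m → Fin n) → and (map p (tabulate g)) ≡ true → ∀ i → p (g i) ≡ true
  go (suc m) g all-p Fin.zero    = ∧-true⁻ˡ all-p
  go (suc m) g all-p (Fin.suc i) = go m (g ∘ Fin.suc) (∧-true⁻ʳ {p (g Fin.zero)} all-p) i

allᵇ-allFin⁺ : ∀ {n} {p : Fin n → Bool} → (∀ i → p i ≡ true) → allᵇ p (allFin n) ≡ true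
allᵇ-allFin⁺ {n} {p} every = go n id (λ {i} → every i)
  where
  go : ∀ m (g : Fin m → Fin n) → (∀ {i} → p (g i) ≡ true) → and (map p (tabulate g)) ≡ true
  go zero    g _     = refl
  go (suc m) g every = cong₂ _∧_ every (go m (g ∘ Fin.suc) every)

allᵇ-allFin-suc : ∀ {n} (p : Fin (suc n) → Bool) →
                  allᵇ p (allFin (suc n)) ≡ p Fin.zero ∧ allᵇ (p ∘ Fin.suc) (allFin n)
allᵇ-allFin-suc p =
  cong (λ bs → p Fin.zero ∧ and bs) (trans (map-tabulate Fin.suc p) (sym (map-tabulate id (p ∘ Fin.suc))))

allᵇ-allFin-cong : ∀ {n} {p q : Fin n → Bool} → p ≗ q → allᵇ p (allFin n) ≡ allᵇ q (allFin n)
allᵇ-allFin-cong {p = p} {q} p≗q =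
  bool-ext (λ all-p → allᵇ-allFin⁺ (λ i → trans (sym (p≗q i)) (allᵇ-allFin⁻ {p = p} all-p i)))
           (λ all-q → allᵇ-allFin⁺ (λ i → trans (p≗q i) (allᵇ-allFin⁻ {p = q} all-q i)))

∑-ones : ∀ n → ∑[ i < n ] 1 ≡ n
∑-ones zero    = refl
∑-ones (suc n) = cong suc (∑-ones n)

∑-fiber : ∀ {n k} (h : Fin n → Fin k) → ∑[ i < k ] fiber h i ≡ n
∑-fiber {n} {k} h = begin
  ∑[ i < k ] fiber h i                      ≡⟨ sum-cong-≗ {k} (λ i → count-allFin (λ v → h v ==ᶠ i)) ⟩
  ∑[ i < k ] ∑[ v < n ] [ h v ==ᶠ i ]       ≡⟨ ∑-comm (λ i v → [ h v ==ᶠ i ]) ⟩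
  ∑[ v < n ] ∑[ i < k ] [ h v ==ᶠ i ]       ≡⟨ sum-cong-≗ {n} (λ v → ∑-δ k (h v)) ⟩
  ∑[ v < n ] 1                              ≡⟨ ∑-ones n ⟩
  n                                         ∎

∑-∘-uniformFibres : ∀ {n m} (e : Fin n → Fin m) {c} → (∀ j → fiber e j ≡ c) →
                    ∀ (G : Fin m → ℕ) → ∑[ v < n ] G (e v) ≡ c * ∑[ j < m ] G j
∑-∘-uniformFibres {n} {m} e {c} fibres G = begin
  ∑[ v < n ] G (e v)                              ≡⟨ sum-cong-≗ {n} (λ v → ∑-select m (e v) G) ⟨
  ∑[ v < n ] ∑[ j < m ] ([ e v ==ᶠ j ] * G j)     ≡⟨ ∑-comm (λ v j → [ e v ==ᶠ j ] * G j) ⟩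
  ∑[ j < m ] ∑[ v < n ] ([ e v ==ᶠ j ] * G j)     ≡⟨ sum-cong-≗ {m} fibre-weight ⟨
  ∑[ j < m ] (c * G j)                            ≡⟨ *-distribˡ-sum c G ⟨
  c * ∑[ j < m ] G j                              ∎
  where
  fibre-weight : ∀ j → c * G j ≡ ∑[ v < n ] ([ e v ==ᶠ j ] * G j)
  fibre-weight j = begin
    c * G j                               ≡⟨ cong (_* G j) (trans (sym (fibres j)) (count-allFin (λ v → e v ==ᶠ j))) ⟩
    ∑[ v < n ] [ e v ==ᶠ j ] * G j        ≡⟨ *-distribʳ-sum (G j) (λ v → [ e v ==ᶠ j ]) ⟩
    ∑[ v < n ] ([ e v ==ᶠ j ] * G j)      ∎

infix 5 _≗ᵇ_

_≗ᵇ_ : ∀ {n k} → (Fin n → Fin k) → (Fin n → Fin k) → Bool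
f ≗ᵇ g = allᵇ (λ v → f v ==ᶠ g v) (allFin _)

≗ᵇ⇒≗ : ∀ {n k} {f g : Fin n → Fin k} → f ≗ᵇ g ≡ true → f ≗ g
≗ᵇ⇒≗ f≗g = ==ᶠ⇒≡ ∘ allᵇ-allFin⁻ f≗g

≗⇒≗ᵇ : ∀ {n k} {f g : Fin n → Fin k} → f ≗ g → f ≗ᵇ g ≡ true
≗⇒≗ᵇ f≗g = allᵇ-allFin⁺ (≡⇒==ᶠ ∘ f≗g)

count-≗ᵇ-allFuns : ∀ n k (f : Fin n → Fin k) → count (f ≗ᵇ_) (allFuns n k) ≡ 1
count-≗ᵇ-allFuns zero    k f = refl
count-≗ᵇ-allFuns (suc n) k f = begin
  count (f ≗ᵇ_) (allFuns (suc n) k)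
    ≡⟨ count≡∑ˡ (f ≗ᵇ_) (allFuns (suc n) k) ⟩
  ∑[ g ∈ allFuns (suc n) k ] [ f ≗ᵇ g ]
    ≡⟨ ∑ˡ-concatMap _ (allFuns n k) (λ g → [ f ≗ᵇ g ]) ⟩
  ∑[ g ∈ allFuns n k ] ∑[ g′ ∈ map (λ c → consF c g) (allFin k) ] [ f ≗ᵇ g′ ]
    ≡⟨ ∑ˡ-cong (allFuns n k) (λ g → trans (∑ˡ-map _ (allFin k) _) (∑ˡ-allFin k _)) ⟩
  ∑[ g ∈ allFuns n k ] ∑[ c < k ] [ f ≗ᵇ consF c g ]
    ≡⟨ ∑ˡ-cong (allFuns n k) (λ g → trans (sum-cong-≗ {k} (split g)) (∑-select k (f Fin.zero) _)) ⟩
  ∑[ g ∈ allFuns n k ] [ f ∘ Fin.suc ≗ᵇ g ]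
    ≡⟨ count≡∑ˡ (f ∘ Fin.suc ≗ᵇ_) (allFuns n k) ⟨
  count (f ∘ Fin.suc ≗ᵇ_) (allFuns n k)
    ≡⟨ count-≗ᵇ-allFuns n k (f ∘ Fin.suc) ⟩
  1 ∎
  where
  split : ∀ g c → [ f ≗ᵇ consF c g ] ≡ [ f Fin.zero ==ᶠ c ] * [ f ∘ Fin.suc ≗ᵇ g ]
  split g c = trans (cong [_] (allᵇ-allFin-suc (λ v → f v ==ᶠ consF c g v)))
                    ([∧] (f Fin.zero ==ᶠ c) (f ∘ Fin.suc ≗ᵇ g))

-- Functions are compared pointwise, since allFuns lists each function exactly once up to ≗.
count-bijection :
  ∀ {m k n l} {P : (Fin m → Fin k) → Bool} {Q : (Fin n → Fin l) → Bool}
  (φ : (Fin m → Fin k) → Fin n → Fin l) (ψ : ∀ g → Q g ≡ true → Fin m → Fin k) →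
  (∀ f g → P f ≡ true → φ f ≗ g → Q g ≡ true) →
  (∀ f g (q : Q g ≡ true) → P f ≡ true → φ f ≗ g → f ≗ ψ g q) →
  (∀ f g (q : Q g ≡ true) → f ≗ ψ g q → P f ≡ true × φ f ≗ g) →
  count P (allFuns m k) ≡ count Q (allFuns n l)
count-bijection {m} {k} {n} {l} {P} {Q} φ ψ φ-Q φ-ψ ψ-P =
  double-count (allFuns m k) (allFuns n l) R rows cols
  where
  R : (Fin m → Fin k) → (Fin n → Fin l) → Bool
  R f g = P f ∧ (φ f ≗ᵇ g)

  rows : ∀ f → count (R f) (allFuns n l) ≡ [ P f ]
  rows f with P f
  ... | true  = count-≗ᵇ-allFuns n l (φ f)
  ... | false = count-none (allFuns n l) (λ _ → refl)

  cols : ∀ g → count (flip R g) (allFuns m k) ≡ [ Q g ]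
  cols g with Q g in q
  ... | true  = trans (count-cong (allFuns m k) (λ f → bool-ext (to f) (from f)))
                      (count-≗ᵇ-allFuns m k (ψ g q))
    where
    to : ∀ f → R f g ≡ true → (ψ g q ≗ᵇ f) ≡ true
    to f r = ≗⇒≗ᵇ (sym ∘ φ-ψ f g q (∧-true⁻ˡ r) (≗ᵇ⇒≗ (∧-true⁻ʳ {P f} r)))
    from : ∀ f → (ψ g q ≗ᵇ f) ≡ true → R f g ≡ true
    from f f≗ψ = let (pf , φf≗g) = ψ-P f g q (sym ∘ ≗ᵇ⇒≗ f≗ψ) in cong₂ _∧_ pf (≗⇒≗ᵇ φf≗g)
  ... | false = count-none (allFuns m k) (λ f → ¬-not λ r →
                  not-¬ (φ-Q f g (∧-true⁻ˡ r) (≗ᵇ⇒≗ (∧-true⁻ʳ {P f} r))) q)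

-- Block assignments

hasBlockSizes : ∀ {n k} → (Fin k → ℕ) → (Fin n → Fin k) → Bool
hasBlockSizes {k = k} F f = allᵇ (λ i → fiber f i ≡ᵇ F i) (allFin k)

hasBlockSizes⁻ : ∀ {n k} {F : Fin k → ℕ} {f : Fin n → Fin k} →
                 hasBlockSizes F f ≡ true → ∀ i → fiber f i ≡ F i
hasBlockSizes⁻ {F = F} {f} sizes = ≡ᵇ-true⇒≡ ∘ allᵇ-allFin⁻ {p = λ i → fiber f i ≡ᵇ F i} sizes

hasBlockSizes⁺ : ∀ {n k} {F : Fin k → ℕ} (f : Fin n → Fin k) →
                 (∀ i → fiber f i ≡ F i) → hasBlockSizes F f ≡ true
hasBlockSizes⁺ f sizes = allᵇ-allFin⁺ (≡⇒≡ᵇ-true ∘ sizes)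

hasBlockSizes⇒∑ : ∀ {n k} {F : Fin k → ℕ} {f : Fin n → Fin k} →
                  hasBlockSizes F f ≡ true → ∑[ i < k ] F i ≡ n
hasBlockSizes⇒∑ {k = k} {f = f} sizes =
  trans (sum-cong-≗ {k} (sym ∘ hasBlockSizes⁻ {f = f} sizes)) (∑-fiber f)

inducesMatchings-kernel : ∀ {n k k′} (g : Graph n) {f : Fin n → Fin k} {f′ : Fin n → Fin k′} →
                          (∀ v w → (f w ==ᶠ f v) ≡ (f′ w ==ᶠ f′ v)) →
                          inducesMatchings g f ≡ inducesMatchings g f′
inducesMatchings-kernel {n} g same-blocks = allᵇ-allFin-cong λ v →
  cong (_≡ᵇ 1) (count-cong (allFin n) λ w → cong (_∧ adj g v w) (same-blocks v w))

#matchingAssignments : ∀ {n} → Graph n → ∀ {k} → (Fin k → ℕ) → ℕ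
#matchingAssignments {n} g {k} F =
  count (λ f → hasBlockSizes F f ∧ inducesMatchings g f) (allFuns n k)

#matchingAssignments-cong : ∀ {n} (g : Graph n) {k} {F F′ : Fin k → ℕ} → F ≗ F′ →
                            #matchingAssignments g F ≡ #matchingAssignments g F′
#matchingAssignments-cong {n} g {k} F≗F′ = count-cong (allFuns n k) λ f →
  cong (_∧ inducesMatchings g f) (allᵇ-allFin-cong λ i → cong (fiber f i ≡ᵇ_) (F≗F′ i))

module _ {n} (g : Graph n) {k k′} {F : Fin k → ℕ} {e : Fin k′ → Fin k}
         (e-injective : Injective _≡_ _≡_ e)
         (F-outside-image : ∀ j → (∀ i → e i ≢ j) → F j ≡ 0) where

  private
    P : (Fin n → Fin k′) → Bool
    P f = hasBlockSizes (F ∘ e) f ∧ inducesMatchings g f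

    Q : (Fin n → Fin k) → Bool
    Q h = hasBlockSizes F h ∧ inducesMatchings g h

    module _ {f : Fin n → Fin k′} {h : Fin n → Fin k} (e∘f≗h : e ∘ f ≗ h) where

      fiber-image : ∀ i → fiber h (e i) ≡ fiber f i
      fiber-image i = count-cong (allFin n) λ v →
        trans (cong (_==ᶠ e i) (sym (e∘f≗h v))) (==ᶠ-injective e-injective (f v) i)

      fiber-outside-image : ∀ j → (∀ i → e i ≢ j) → fiber h j ≡ 0
      fiber-outside-image j j∉image = count-none (allFin n) λ v →
        ≢⇒==ᶠ (j∉image (f v) ∘ trans (e∘f≗h v))

      inducesMatchings-image : inducesMatchings g h ≡ inducesMatchings g f
      inducesMatchings-image = inducesMatchings-kernel g λ v w →
        trans (cong₂ _==ᶠ_ (sym (e∘f≗h w)) (sym (e∘f≗h v))) (==ᶠ-injective e-injective (f w) (f v))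

    preimage : ∀ {h} → Q h ≡ true → ∀ v → ∃[ i ] e i ≡ h v
    preimage {h} q v with any? (λ i → e i Fin.≟ h v)
    ... | yes found    = found
    ... | no not-found = ⊥-elim (count-positive (λ w → h w ==ᶠ h v) (∈-allFin v) (≡⇒==ᶠ refl) h[v]-empty)
      where
      h[v]-empty : fiber h (h v) ≡ 0
      h[v]-empty = trans (hasBlockSizes⁻ {f = h} (∧-true⁻ˡ q) (h v)) (F-outside-image (h v) (curry not-found))

  #matchingAssignments-reindex : #matchingAssignments g (F ∘ e) ≡ #matchingAssignments g F
  #matchingAssignments-reindex =
    count-bijection (e ∘_) (λ h q v → proj₁ (preimage q v)) image-Q image-preimage preimage-P
    where
    image-Q : ∀ f h → P f ≡ true → e ∘ f ≗ h → Q h ≡ true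
    image-Q f h p e∘f≗h =
      cong₂ _∧_ (hasBlockSizes⁺ h sizes) (trans (inducesMatchings-image e∘f≗h) (∧-true⁻ʳ p))
      where
      sizes : ∀ j → fiber h j ≡ F j
      sizes j with any? (λ i → e i Fin.≟ j)
      ... | yes (i , refl) = trans (fiber-image e∘f≗h i) (hasBlockSizes⁻ {f = f} (∧-true⁻ˡ p) i)
      ... | no not-found   = trans (fiber-outside-image e∘f≗h j (curry not-found))
                                   (sym (F-outside-image j (curry not-found)))

    image-preimage : ∀ f h (q : Q h ≡ true) → P f ≡ true → e ∘ f ≗ h → f ≗ (λ v → proj₁ (preimage q v))
    image-preimage f h q _ e∘f≗h v = e-injective (trans (e∘f≗h v) (sym (proj₂ (preimage q v))))

    preimage-P : ∀ f h (q : Q h ≡ true) → f ≗ (λ v → proj₁ (preimage q v)) → P f ≡ true × e ∘ f ≗ h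
    preimage-P f h q f≗ =
      cong₂ _∧_ (hasBlockSizes⁺ f sizes) (trans (sym (inducesMatchings-image e∘f≗h)) (∧-true⁻ʳ q)) , e∘f≗h
      where
      e∘f≗h : e ∘ f ≗ h
      e∘f≗h v = trans (cong e (f≗ v)) (proj₂ (preimage q v))
      sizes : ∀ i → fiber f i ≡ F (e i)
      sizes i = trans (sym (fiber-image e∘f≗h i)) (hasBlockSizes⁻ {f = h} (∧-true⁻ˡ q) (e i))

skipZero : ∀ β γ → Fin (length (β ++ γ)) → Fin (length (β ++ 0 ∷ γ))
skipZero []      γ i           = Fin.suc i
skipZero (_ ∷ β) γ Fin.zero    = Fin.zero
skipZero (_ ∷ β) γ (Fin.suc i) = Fin.suc (skipZero β γ i)

skipZero-injective : ∀ β γ → Injective _≡_ _≡_ (skipZero β γ)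
skipZero-injective []      γ eq = suc-injective eq
skipZero-injective (_ ∷ β) γ {Fin.zero}  {Fin.zero}  _  = refl
skipZero-injective (_ ∷ β) γ {Fin.suc i} {Fin.suc j} eq =
  cong Fin.suc (skipZero-injective β γ (suc-injective eq))

lookup-skipZero : ∀ β γ i → lookup (β ++ 0 ∷ γ) (skipZero β γ i) ≡ lookup (β ++ γ) i
lookup-skipZero []      γ i           = refl
lookup-skipZero (_ ∷ β) γ Fin.zero    = refl
lookup-skipZero (_ ∷ β) γ (Fin.suc i) = lookup-skipZero β γ i

lookup-outside-skipZero : ∀ β γ j → (∀ i → skipZero β γ i ≢ j) → lookup (β ++ 0 ∷ γ) j ≡ 0
lookup-outside-skipZero []      γ Fin.zero    _        = refl
lookup-outside-skipZero []      γ (Fin.suc j) j∉image  = ⊥-elim (j∉image j refl)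
lookup-outside-skipZero (_ ∷ β) γ Fin.zero    j∉image  = ⊥-elim (j∉image Fin.zero refl)
lookup-outside-skipZero (_ ∷ β) γ (Fin.suc j) j∉image  =
  lookup-outside-skipZero β γ j (λ i → j∉image (Fin.suc i) ∘ cong Fin.suc)

#matchingAssignments-insertZero : ∀ {n} (g : Graph n) β γ →
  #matchingAssignments g (lookup (β ++ γ)) ≡ #matchingAssignments g (lookup (β ++ 0 ∷ γ))
#matchingAssignments-insertZero g β γ =
  trans (#matchingAssignments-cong g (sym ∘ lookup-skipZero β γ))
        (#matchingAssignments-reindex g (skipZero-injective β γ) (lookup-outside-skipZero β γ))

dropZeros : List ℕ → List ℕ
dropZeros = filterᵇ (λ x → not (x ≡ᵇ 0))

#matchingAssignments-dropZeros : ∀ {n} (g : Graph n) α →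
  #matchingAssignments g (lookup α) ≡ #matchingAssignments g (lookup (dropZeros α))
#matchingAssignments-dropZeros g α = behind [] α
  where
  N : List ℕ → ℕ
  N β = #matchingAssignments g (lookup β)

  behind : ∀ β α → N (β ++ α) ≡ N (β ++ dropZeros α)
  behind β []          = refl
  behind β (zero ∷ α)  = trans (sym (#matchingAssignments-insertZero g β α)) (behind β α)
  behind β (suc x ∷ α) = begin
    N (β ++ suc x ∷ α)                    ≡⟨ cong N (++-assoc β (suc x ∷ []) α) ⟨
    N ((β ++ suc x ∷ []) ++ α)            ≡⟨ behind (β ++ suc x ∷ []) α ⟩
    N ((β ++ suc x ∷ []) ++ dropZeros α)  ≡⟨ cong N (++-assoc β (suc x ∷ []) (dropZeros α)) ⟩
    N (β ++ suc x ∷ dropZeros α)          ∎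

-- Compositions and the left-hand side

infix 4 _==ˡ_

_==ˡ_ : List ℕ → List ℕ → Bool
β ==ˡ a = ⌊ ≡-dec ℕ._≟_ β a ⌋

==ˡ⇒≡ : ∀ {β a} → (β ==ˡ a) ≡ true → β ≡ a
==ˡ⇒≡ = ⌊⌋-true⇒

==ˡ-refl : ∀ β → (β ==ˡ β) ≡ true
==ˡ-refl β = ⇒⌊⌋-true refl

∷-==ˡ : ∀ x y xs ys → (x ∷ xs ==ˡ y ∷ ys) ≡ ((x ≡ᵇ y) ∧ (xs ==ˡ ys))
∷-==ˡ x y xs ys = bool-ext to from
  where
  to : (x ∷ xs ==ˡ y ∷ ys) ≡ true → ((x ≡ᵇ y) ∧ (xs ==ˡ ys)) ≡ true
  to eq with refl ← ==ˡ⇒≡ {x ∷ xs} eq = cong₂ _∧_ (≡⇒≡ᵇ-true {x} refl) (==ˡ-refl xs)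
  from : ((x ≡ᵇ y) ∧ (xs ==ˡ ys)) ≡ true → (x ∷ xs ==ˡ y ∷ ys) ≡ true
  from eq with refl ← ≡ᵇ-true⇒≡ {x} (∧-true⁻ˡ eq) | refl ← ==ˡ⇒≡ {xs} (∧-true⁻ʳ {x ≡ᵇ y} eq) =
    ==ˡ-refl (x ∷ xs)

isCompositionOf : ℕ → List ℕ → Bool
isCompositionOf n β = allᵇ (λ x → not (x ≡ᵇ 0)) β ∧ (sum β ≡ᵇ n)

==ˡ-[] : ∀ β → [ β ==ˡ [] ] ≡ [ isCompositionOf 0 β ]
==ˡ-[] []            = refl
==ˡ-[] (zero ∷ β)    = refl
==ˡ-[] (suc x ∷ β)   = cong [_] (sym (∧-zeroʳ _))

==ˡ-[1] : ∀ β → [ β ==ˡ 1 ∷ [] ] ≡ [ isCompositionOf 1 β ]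
==ˡ-[1] []                = refl
==ˡ-[1] (zero ∷ β)        = cong [_] (∷-==ˡ 0 1 β [])
==ˡ-[1] (suc zero ∷ β)    = trans (cong [_] (∷-==ˡ 1 1 β [])) (==ˡ-[] β)
==ˡ-[1] (suc (suc x) ∷ β) = cong [_] (trans (∷-==ˡ (suc (suc x)) 1 β []) (sym (∧-zeroʳ _)))

==ˡ-bump : ∀ x β c → (suc x ∷ β ==ˡ bump c) ≡ (x ∷ β ==ˡ c)
==ˡ-bump x β []      = refl
==ˡ-bump x β (y ∷ c) = trans (∷-==ˡ (suc x) (suc y) β c) (sym (∷-==ˡ x y β c))

[]-==ˡ-bump : ∀ c → ([] ==ˡ bump c) ≡ ([] ==ˡ c)
[]-==ˡ-bump []      = refl
[]-==ˡ-bump (_ ∷ _) = refl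

zero-==ˡ-bump : ∀ β c → (0 ∷ β ==ˡ bump c) ≡ false
zero-==ˡ-bump β []      = refl
zero-==ˡ-bump β (y ∷ c) = ∷-==ˡ 0 (suc y) β c

compositions-step : ∀ n →
  (∀ β → count (β ==ˡ_) (compositions (suc n)) ≡ [ isCompositionOf (suc n) β ]) →
  ∀ β → count (β ==ˡ_) (compositions (suc (suc n))) ≡ [ isCompositionOf (suc (suc n)) β ]
compositions-step n count-C β = begin
  count (β ==ˡ_) (compositions (suc (suc n)))
    ≡⟨ count≡∑ˡ (β ==ˡ_) (concatMap next C) ⟩
  ∑ˡ (concatMap next C) (λ a → [ β ==ˡ a ])
    ≡⟨ ∑ˡ-concatMap next C _ ⟩
  ∑[ c ∈ C ] ([ β ==ˡ 1 ∷ c ] + ([ β ==ˡ bump c ] + 0))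
    ≡⟨ by-first-part β ⟩
  [ isCompositionOf (suc (suc n)) β ] ∎
  where
  C : List (List ℕ)
  C = compositions (suc n)

  next : List ℕ → List (List ℕ)
  next c = (1 ∷ c) ∷ bump c ∷ []

  IH : ∀ β → ∑[ c ∈ C ] [ β ==ˡ c ] ≡ [ isCompositionOf (suc n) β ]
  IH β = trans (sym (count≡∑ˡ (β ==ˡ_) C)) (count-C β)

  by-first-part : ∀ β → ∑[ c ∈ C ] ([ β ==ˡ 1 ∷ c ] + ([ β ==ˡ bump c ] + 0)) ≡
                        [ isCompositionOf (suc (suc n)) β ]
  by-first-part [] = trans (∑ˡ-cong C (λ c → trans (+-identityʳ _) (cong [_] ([]-==ˡ-bump c)))) (IH [])
  by-first-part (zero ∷ β) =
    trans (∑ˡ-cong C λ c → cong₂ _+_ (cong [_] (∷-==ˡ 0 1 β c))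
                                     (cong (λ b → [ b ] + 0) (zero-==ˡ-bump β c)))
          (∑ˡ-zero C)
  by-first-part (suc zero ∷ β) = begin
    ∑[ c ∈ C ] ([ 1 ∷ β ==ˡ 1 ∷ c ] + ([ 1 ∷ β ==ˡ bump c ] + 0))
      ≡⟨ ∑ˡ-cong C (λ c → cong₂ _+_ (cong [_] (∷-==ˡ 1 1 β c))
                                    (trans (+-identityʳ _) (cong [_] (==ˡ-bump 0 β c)))) ⟩
    ∑[ c ∈ C ] ([ β ==ˡ c ] + [ 0 ∷ β ==ˡ c ])
      ≡⟨ ∑ˡ-distrib-+ C _ _ ⟩
    ∑[ c ∈ C ] [ β ==ˡ c ] + ∑[ c ∈ C ] [ 0 ∷ β ==ˡ c ]
      ≡⟨ cong₂ _+_ (IH β) (IH (0 ∷ β)) ⟩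
    [ isCompositionOf (suc n) β ] + 0
      ≡⟨ +-identityʳ _ ⟩
    [ isCompositionOf (suc (suc n)) (1 ∷ β) ] ∎
  by-first-part (suc (suc x) ∷ β) =
    trans (∑ˡ-cong C (λ c → cong₂ _+_ (cong [_] (∷-==ˡ (suc (suc x)) 1 β c))
                                      (trans (+-identityʳ _) (cong [_] (==ˡ-bump (suc x) β c)))))
          (IH (suc x ∷ β))

count-compositions : ∀ n β → count (β ==ˡ_) (compositions n) ≡ [ isCompositionOf n β ]
count-compositions zero          β = trans (count≡∑ˡ (β ==ˡ_) _) (trans (+-identityʳ _) (==ˡ-[] β))
count-compositions (suc zero)    β = trans (count≡∑ˡ (β ==ˡ_) _) (trans (+-identityʳ _) (==ˡ-[1] β))
count-compositions (suc (suc n)) β = compositions-step n (count-compositions (suc n)) β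

∑-lookup : ∀ β → ∑[ i < length β ] lookup β i ≡ sum β
∑-lookup []      = refl
∑-lookup (b ∷ β) = cong (b +_) (∑-lookup β)

dropZeros-positive : ∀ α → allᵇ (λ x → not (x ≡ᵇ 0)) (dropZeros α) ≡ true
dropZeros-positive []          = refl
dropZeros-positive (zero ∷ α)  = dropZeros-positive α
dropZeros-positive (suc _ ∷ α) = dropZeros-positive α

Ψcoeff≡#matchingAssignments : ∀ {n} (g : Graph n) α →
  Ψcoeff g α ≡ #matchingAssignments g (lookup (dropZeros α))
Ψcoeff≡#matchingAssignments {n} g α = begin
  ∑[ a ∈ C ] (N a * [ β ==ˡ a ])        ≡⟨ ∑ˡ-cong C only-β ⟩
  ∑[ a ∈ C ] (N β * [ β ==ˡ a ])        ≡⟨ *-distribˡ-∑ˡ C (N β) (λ a → [ β ==ˡ a ]) ⟨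
  N β * ∑[ a ∈ C ] [ β ==ˡ a ]          ≡⟨ cong (N β *_) (count≡∑ˡ (β ==ˡ_) C) ⟨
  N β * count (β ==ˡ_) C                ≡⟨ cong (N β *_) (count-compositions n β) ⟩
  N β * [ isCompositionOf n β ]         ≡⟨ count-*-implied (allFuns n (length β)) _ composition ⟩
  N β                                   ∎
  where
  β : List ℕ
  β = dropZeros α
  C : List (List ℕ)
  C = compositions n

  N : List ℕ → ℕ
  N a = #matchingAssignments g (lookup a)

  only-β : ∀ a → N a * [ β ==ˡ a ] ≡ N β * [ β ==ˡ a ]
  only-β a with β ==ˡ a in β≡a
  ... | true  rewrite ==ˡ⇒≡ β≡a = refl
  ... | false = trans (*-zeroʳ (N a)) (sym (*-zeroʳ (N β)))

  composition : ∀ f → (hasBlockSizes (lookup β) f ∧ inducesMatchings g f) ≡ true → isCompositionOf n β ≡ true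
  composition f assignment = cong₂ _∧_ (dropZeros-positive α)
    (≡⇒≡ᵇ-true (trans (sym (∑-lookup β)) (hasBlockSizes⇒∑ {f = f} (∧-true⁻ˡ assignment))))

-- Matchings induced by blocks

sameBlockNeighbour : ∀ {n k} → Graph n → (Fin n → Fin k) → Fin n → Fin n → Bool
sameBlockNeighbour g h v w = (h w ==ᶠ h v) ∧ adj g v w

record BlockMatching {n k} (g : Graph n) (h : Fin n → Fin k) (π : Fin n → Fin n) : Set where
  constructor blockMatching
  field
    sameBlockNeighbour≡ : ∀ v w → sameBlockNeighbour g h v w ≡ (π v ==ᶠ w)
open BlockMatching

isBlockMatching : ∀ {n k} → Graph n → (Fin n → Fin k) → (Fin n → Fin n) → Bool
isBlockMatching {n} g h π =
  allᵇ (λ v → allᵇ (λ w → ⌊ sameBlockNeighbour g h v w Bool.≟ (π v ==ᶠ w) ⌋) (allFin n)) (allFin n)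

isBlockMatching⁻ : ∀ {n k} {g : Graph n} {h : Fin n → Fin k} {π} →
                   isBlockMatching g h π ≡ true → BlockMatching g h π
isBlockMatching⁻ bm = blockMatching λ v w → ⌊⌋-true⇒ (allᵇ-allFin⁻ (allᵇ-allFin⁻ bm v) w)

isBlockMatching⁺ : ∀ {n k} {g : Graph n} {h : Fin n → Fin k} {π} →
                   BlockMatching g h π → isBlockMatching g h π ≡ true
isBlockMatching⁺ bm = allᵇ-allFin⁺ λ v → allᵇ-allFin⁺ λ w → ⇒⌊⌋-true (sameBlockNeighbour≡ bm v w)

module _ {n k} {g : Graph n} {h : Fin n → Fin k} {π : Fin n → Fin n} (bm : BlockMatching g h π) where

  blockMatching-sameBlock : ∀ v → h (π v) ≡ h v
  blockMatching-sameBlock v = ==ᶠ⇒≡ (∧-true⁻ˡ (trans (sameBlockNeighbour≡ bm v (π v)) (≡⇒==ᶠ refl)))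

  blockMatching-adj : ∀ v → adj g v (π v) ≡ true
  blockMatching-adj v = ∧-true⁻ʳ {h (π v) ==ᶠ h v} (trans (sameBlockNeighbour≡ bm v (π v)) (≡⇒==ᶠ refl))

  blockMatching-unique : ∀ {v w} → h w ≡ h v → adj g v w ≡ true → w ≡ π v
  blockMatching-unique {v} {w} same v~w =
    sym (==ᶠ⇒≡ (trans (sym (sameBlockNeighbour≡ bm v w)) (cong₂ _∧_ (≡⇒==ᶠ same) v~w)))

  blockMatching-isPerfectMatching : isPerfectMatching g π ≡ true
  blockMatching-isPerfectMatching = allᵇ-allFin⁺ λ v →
    cong₂ _∧_ (≡⇒==ᶠ (sym (blockMatching-unique (sym (blockMatching-sameBlock v))
                                                  (trans (Graph.sym g (π v) v) (blockMatching-adj v)))))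
              (cong₂ _∧_ (cong not (≢⇒==ᶠ λ πv≡v → not-¬ (blockMatching-adj v)
                                                     (trans (cong (adj g v) πv≡v) (irrefl g v))))
                         (blockMatching-adj v))

count-blockMatchings : ∀ {n k} (g : Graph n) (h : Fin n → Fin k) →
                       count (isBlockMatching g h) (allFuns n n) ≡ [ inducesMatchings g h ]
count-blockMatchings {n} g h with inducesMatchings g h in matched
... | true  = trans (count-cong (allFuns n n) (λ π → bool-ext (toPartner π) (fromPartner π)))
                    (count-≗ᵇ-allFuns n n partner)
  where
  oneNeighbour : ∀ v → count (sameBlockNeighbour g h v) (allFin n) ≡ 1
  oneNeighbour v = ≡ᵇ-true⇒≡ (allᵇ-allFin⁻ matched v)

  partnerOf : ∀ v → ∃[ w ] sameBlockNeighbour g h v w ≡ true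
  partnerOf v = count-witness (allFin n) (sameBlockNeighbour g h v) λ c≡0 →
    1≢0 (trans (sym (oneNeighbour v)) c≡0)
    where
    1≢0 : 1 ≢ 0
    1≢0 ()

  partner : Fin n → Fin n
  partner = proj₁ ∘ partnerOf

  partner-BlockMatching : BlockMatching g h partner
  partner-BlockMatching = blockMatching λ v w → bool-ext
    (λ v∼w → ≡⇒==ᶠ (count≡1⇒unique (sameBlockNeighbour g h v) (oneNeighbour v)
                                    (∈-allFin (partner v)) (proj₂ (partnerOf v)) (∈-allFin w) v∼w))
    (λ p≡w → subst (λ u → sameBlockNeighbour g h v u ≡ true) (==ᶠ⇒≡ p≡w) (proj₂ (partnerOf v)))

  toPartner : ∀ π → isBlockMatching g h π ≡ true → (partner ≗ᵇ π) ≡ true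
  toPartner π bm = ≗⇒≗ᵇ λ v → let v∼p = proj₂ (partnerOf v) in
    blockMatching-unique (isBlockMatching⁻ {g = g} {h} bm) (==ᶠ⇒≡ (∧-true⁻ˡ v∼p))
                         (∧-true⁻ʳ {h (partner v) ==ᶠ h v} v∼p)

  fromPartner : ∀ π → (partner ≗ᵇ π) ≡ true → isBlockMatching g h π ≡ true
  fromPartner π p≗π = isBlockMatching⁺ {g = g} {h} (blockMatching λ v w →
    trans (sameBlockNeighbour≡ partner-BlockMatching v w) (cong (_==ᶠ w) (≗ᵇ⇒≗ p≗π v)))
... | false = count-none (allFuns n n) λ π → ¬-not λ bm →
                not-¬ (matchedBy π (isBlockMatching⁻ {g = g} {h} bm)) matched
  where
  matchedBy : ∀ π → BlockMatching g h π → inducesMatchings g h ≡ true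
  matchedBy π bm = allᵇ-allFin⁺ λ v → ≡⇒≡ᵇ-true (begin
    count (sameBlockNeighbour g h v) (allFin n) ≡⟨ count-cong (allFin n) (sameBlockNeighbour≡ bm v) ⟩
    count (π v ==ᶠ_) (allFin n)                 ≡⟨ count-allFin (π v ==ᶠ_) ⟩
    ∑[ w < n ] [ π v ==ᶠ w ]                    ≡⟨ ∑-δ n (π v) ⟩
    1                                           ∎)

isProper⁻ : ∀ {m k} {hadj : Fin m → Fin m → Bool} {κ : Fin m → Fin k} →
            isProper hadj κ ≡ true → ∀ {u u′} → hadj u u′ ≡ true → κ u ≢ κ u′
isProper⁻ proper {u} {u′} u~u′ same =
  not-¬ (cong₂ _∧_ u~u′ (≡⇒==ᶠ same)) (not-injective (allᵇ-allFin⁻ (allᵇ-allFin⁻ proper u) u′))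

isProper⁺ : ∀ {m k} {hadj : Fin m → Fin m → Bool} {κ : Fin m → Fin k} →
            (∀ {u u′} → hadj u u′ ≡ true → κ u ≢ κ u′) → isProper hadj κ ≡ true
isProper⁺ {hadj = hadj} proper = allᵇ-allFin⁺ λ u → allᵇ-allFin⁺ λ u′ →
  cong not (¬-not λ both → proper (∧-true⁻ˡ both) (==ᶠ⇒≡ (∧-true⁻ʳ {hadj u u′} both)))

-- Colourings of the contracted graph g↓π

module PerfectMatching {n} (g : Graph n) {π : Fin n → Fin n} (pm : isPerfectMatching g π ≡ true) where

  private
    π-conditions : ∀ v → ((π (π v) ==ᶠ v) ∧ not (π v ==ᶠ v) ∧ adj g v (π v)) ≡ true
    π-conditions = allᵇ-allFin⁻ pm

  π-involutive : ∀ v → π (π v) ≡ v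
  π-involutive v = ==ᶠ⇒≡ (∧-true⁻ˡ (π-conditions v))

  π-fixpointFree : ∀ v → π v ≢ v
  π-fixpointFree v πv≡v = not-¬ (≡⇒==ᶠ πv≡v)
    (not-injective (∧-true⁻ˡ (∧-true⁻ʳ {π (π v) ==ᶠ v} (π-conditions v))))

  adj-π : ∀ v → adj g v (π v) ≡ true
  adj-π v = ∧-true⁻ʳ {not (π v ==ᶠ v)} (∧-true⁻ʳ {π (π v) ==ᶠ v} (π-conditions v))

  -- The vertices of g↓π are the π-edges, listed by their smaller endpoints (edgeReps π);
  -- edge v is the one containing v.
  m : ℕ
  m = downSize π

  edgeRep : Fin m → Fin n
  edgeRep = lookup (edgeReps π)

  private
    isLower : Fin n → Bool
    isLower v = toℕ v <ᵇ toℕ (π v)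

    isLower-π : ∀ v → isLower (π v) ≡ not (isLower v)
    isLower-π v with isLower v in lower-v
    ... | true  = ¬-not λ lower-πv → <-asym (<ᵇ-true⇒< lower-v)
                    (subst (λ w → toℕ (π v) < toℕ w) (π-involutive v) (<ᵇ-true⇒< lower-πv))
    ... | false = subst (λ w → (toℕ (π v) <ᵇ toℕ w) ≡ true) (sym (π-involutive v))
                    (<⇒<ᵇ-true (≤∧≢⇒< (≮⇒≥ λ (v<πv : toℕ v < toℕ (π v)) → not-¬ (<⇒<ᵇ-true v<πv) lower-v)
                                       (π-fixpointFree v ∘ toℕ-injective)))

    lower : Fin n → Fin n
    lower v = if isLower v then v else π v

    lower-isLower : ∀ v → isLower (lower v) ≡ true
    lower-isLower v with isLower v in lower-v
    ... | true  = lower-v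
    ... | false = trans (isLower-π v) (cong not lower-v)

    lower-either : ∀ v → lower v ≡ v ⊎ lower v ≡ π v
    lower-either v with isLower v
    ... | true  = inj₁ refl
    ... | false = inj₂ refl

    lower-π : ∀ v → lower (π v) ≡ lower v
    lower-π v with isLower v in lower-v | isLower (π v) in lower-πv
    ... | true  | false = π-involutive v
    ... | false | true  = refl
    ... | true  | true  = ⊥-elim (not-¬ lower-πv (trans (isLower-π v) (cong not lower-v)))
    ... | false | false = ⊥-elim (not-¬ lower-πv (trans (isLower-π v) (cong not lower-v)))

    lower∈edgeReps : ∀ v → lower v ∈ edgeReps π
    lower∈edgeReps v = ∈-filter⁺ (T? ∘ isLower) (∈-allFin (lower v)) (Equivalence.from T-≡ (lower-isLower v))

  edge : Fin n → Fin m
  edge v = index (lower∈edgeReps v)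

  private
    edgeRep-edge : ∀ v → edgeRep (edge v) ≡ lower v
    edgeRep-edge v = sym (lookup-index (lower∈edgeReps v))

  edgeRep-injective : Injective _≡_ _≡_ edgeRep
  edgeRep-injective = lookup-injective (Unique.filter⁺ (T? ∘ isLower) (Unique.allFin⁺ n))

  edge-edgeRep : ∀ j → edge (edgeRep j) ≡ j
  edge-edgeRep j =
    edgeRep-injective (trans (edgeRep-edge (edgeRep j)) (lower-fixes (edgeRep j) (edgeRep-isLower j)))
    where
    edgeRep-isLower : ∀ j → isLower (edgeRep j) ≡ true
    edgeRep-isLower j = Equivalence.to T-≡ (proj₂ (∈-filter⁻ (T? ∘ isLower) {xs = allFin n} (∈-lookup j)))
    lower-fixes : ∀ v → isLower v ≡ true → lower v ≡ v
    lower-fixes v lower-v rewrite lower-v = refl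

  edge-π : ∀ v → edge (π v) ≡ edge v
  edge-π v = edgeRep-injective (trans (edgeRep-edge (π v)) (trans (lower-π v) (sym (edgeRep-edge v))))

  edgeRep-edge-either : ∀ v → edgeRep (edge v) ≡ v ⊎ edgeRep (edge v) ≡ π v
  edgeRep-edge-either v rewrite edgeRep-edge v = lower-either v

  edge-endpoints : ∀ {w j} → edge w ≡ j → w ≡ edgeRep j ⊎ w ≡ π (edgeRep j)
  edge-endpoints {w} refl with edgeRep-edge-either w
  ... | inj₁ rep≡w  = inj₁ (sym rep≡w)
  ... | inj₂ rep≡πw = inj₂ (trans (sym (π-involutive w)) (cong π (sym rep≡πw)))

  edge-π-edgeRep : ∀ j → edge (π (edgeRep j)) ≡ j
  edge-π-edgeRep j = trans (edge-π (edgeRep j)) (edge-edgeRep j)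

  fiber-edge : ∀ j → fiber edge j ≡ 2
  fiber-edge j = begin
    fiber edge j
      ≡⟨ count-allFin (λ v → edge v ==ᶠ j) ⟩
    ∑[ v < n ] [ edge v ==ᶠ j ]
      ≡⟨ sum-cong-≗ {n} endpoints ⟩
    ∑[ v < n ] ([ edgeRep j ==ᶠ v ] + [ π (edgeRep j) ==ᶠ v ])
      ≡⟨ ∑-distrib-+ (λ v → [ edgeRep j ==ᶠ v ]) _ ⟩
    ∑[ v < n ] [ edgeRep j ==ᶠ v ] + ∑[ v < n ] [ π (edgeRep j) ==ᶠ v ]
      ≡⟨ cong₂ _+_ (∑-δ n (edgeRep j)) (∑-δ n (π (edgeRep j))) ⟩
    2 ∎
    where
    r : Fin n
    r = edgeRep j
    endpoints : ∀ v → [ edge v ==ᶠ j ] ≡ [ r ==ᶠ v ] + [ π r ==ᶠ v ]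
    endpoints v with edge v Fin.≟ j
    ... | yes edge-v≡j with edge-endpoints edge-v≡j
    ...   | inj₁ refl rewrite ≢⇒==ᶠ (π-fixpointFree r) =
      sym (trans (+-identityʳ _) (cong [_] (≡⇒==ᶠ {i = r} refl)))
    ...   | inj₂ refl rewrite ≢⇒==ᶠ (π-fixpointFree r ∘ sym) =
      sym (cong [_] (≡⇒==ᶠ {i = π r} refl))
    endpoints v | no edge-v≢j
      rewrite ≢⇒==ᶠ {i = r} {v} (λ { refl → edge-v≢j (edge-edgeRep j) })
            | ≢⇒==ᶠ {i = π r} {v} (λ { refl → edge-v≢j (edge-π-edgeRep j) }) = refl

  edge≡edge : ∀ {v w} → edge w ≡ edge v → w ≡ v ⊎ w ≡ π v
  edge≡edge {v} {w} same with edge-endpoints same | edgeRep-edge-either v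
  ... | inj₁ w≡r  | inj₁ r≡v  = inj₁ (trans w≡r r≡v)
  ... | inj₁ w≡r  | inj₂ r≡πv = inj₂ (trans w≡r r≡πv)
  ... | inj₂ w≡πr | inj₁ r≡v  = inj₂ (trans w≡πr (cong π r≡v))
  ... | inj₂ w≡πr | inj₂ r≡πv = inj₁ (trans w≡πr (trans (cong π r≡πv) (π-involutive v)))

  downAdj-edge : ∀ {x y} → edge x ≢ edge y → adj g x y ≡ true → downAdj g π (edge x) (edge y) ≡ true
  downAdj-edge {x} {y} distinct xy = cong₂ _∧_ (cong not (≢⇒==ᶠ distinct))
                                               (joined (edge-endpoints refl) (edge-endpoints refl))
    where
    r s : Fin n
    r = edgeRep (edge x)
    s = edgeRep (edge y)
    moved : ∀ {a b} → x ≡ a → y ≡ b → adj g a b ≡ true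
    moved x≡a y≡b = subst₂ (λ a b → adj g a b ≡ true) x≡a y≡b xy
    joined : x ≡ r ⊎ x ≡ π r → y ≡ s ⊎ y ≡ π s →
             ((adj g r s ∨ adj g r (π s)) ∨ (adj g (π r) s ∨ adj g (π r) (π s))) ≡ true
    joined (inj₁ x≡r)  (inj₁ y≡s)  =
      ∨-true⁺ˡ (adj g (π r) s ∨ adj g (π r) (π s)) (∨-true⁺ˡ (adj g r (π s)) (moved x≡r y≡s))
    joined (inj₁ x≡r)  (inj₂ y≡πs) =
      ∨-true⁺ˡ (adj g (π r) s ∨ adj g (π r) (π s)) (∨-true⁺ʳ (adj g r s) (moved x≡r y≡πs))
    joined (inj₂ x≡πr) (inj₁ y≡s)  =
      ∨-true⁺ʳ (adj g r s ∨ adj g r (π s)) (∨-true⁺ˡ (adj g (π r) (π s)) (moved x≡πr y≡s))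
    joined (inj₂ x≡πr) (inj₂ y≡πs) =
      ∨-true⁺ʳ (adj g r s ∨ adj g r (π s)) (∨-true⁺ʳ (adj g (π r) s) (moved x≡πr y≡πs))

  downAdj⇒ : ∀ {i j} → downAdj g π i j ≡ true →
             i ≢ j × ∃[ x ] ∃[ y ] edge x ≡ i × edge y ≡ j × adj g x y ≡ true
  downAdj⇒ {i} {j} i~j = (λ i≡j → not-¬ (≡⇒==ᶠ i≡j) (not-injective (∧-true⁻ˡ i~j)))
                       , joined (∨-true⁻ (∧-true⁻ʳ {not (i ==ᶠ j)} i~j))
    where
    r s : Fin n
    r = edgeRep i
    s = edgeRep j
    joined : (adj g r s ∨ adj g r (π s)) ≡ true ⊎ (adj g (π r) s ∨ adj g (π r) (π s)) ≡ true →
             ∃[ x ] ∃[ y ] edge x ≡ i × edge y ≡ j × adj g x y ≡ true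
    joined (inj₁ r~) with ∨-true⁻ r~
    ... | inj₁ rs  = r   , s   , edge-edgeRep i   , edge-edgeRep j   , rs
    ... | inj₂ rπs = r   , π s , edge-edgeRep i   , edge-π-edgeRep j , rπs
    joined (inj₂ πr~) with ∨-true⁻ πr~
    ... | inj₁ πrs  = π r , s   , edge-π-edgeRep i , edge-edgeRep j   , πrs
    ... | inj₂ πrπs = π r , π s , edge-π-edgeRep i , edge-π-edgeRep j , πrπs

  module _ {L} {κ : Fin m → Fin L} {h : Fin n → Fin L} (κ∘edge≗h : κ ∘ edge ≗ h) where

    fiber-lift : ∀ i → fiber h i ≡ 2 * fiber κ i
    fiber-lift i = begin
      fiber h i                          ≡⟨ count-cong (allFin n) (λ v → cong (_==ᶠ i) (sym (κ∘edge≗h v))) ⟩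
      fiber (κ ∘ edge) i                 ≡⟨ count-allFin (λ v → κ (edge v) ==ᶠ i) ⟩
      ∑[ v < n ] [ κ (edge v) ==ᶠ i ]    ≡⟨ ∑-∘-uniformFibres edge fiber-edge (λ j → [ κ j ==ᶠ i ]) ⟩
      2 * ∑[ j < m ] [ κ j ==ᶠ i ]       ≡⟨ cong (2 *_) (count-allFin (λ j → κ j ==ᶠ i)) ⟨
      2 * fiber κ i                      ∎

    proper⇒blockMatching : isProper (downAdj g π) κ ≡ true → BlockMatching g h π
    proper⇒blockMatching proper = blockMatching λ v w → bool-ext (neighbour⇒π v w) (π⇒neighbour v w)
      where
      neighbour⇒π : ∀ v w → sameBlockNeighbour g h v w ≡ true → (π v ==ᶠ w) ≡ true
      neighbour⇒π v w v∼w with edge w Fin.≟ edge v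
      ... | yes same-edge with edge≡edge same-edge
      ...   | inj₁ refl = ⊥-elim (not-¬ (∧-true⁻ʳ {h v ==ᶠ h v} v∼w) (irrefl g v))
      ...   | inj₂ w≡πv = ≡⇒==ᶠ (sym w≡πv)
      neighbour⇒π v w v∼w | no other-edge =
        ⊥-elim (isProper⁻ {hadj = downAdj g π} {κ} proper
                 (downAdj-edge (other-edge ∘ sym) (∧-true⁻ʳ {h w ==ᶠ h v} v∼w))
                 (trans (κ∘edge≗h v) (trans (sym (==ᶠ⇒≡ (∧-true⁻ˡ v∼w))) (sym (κ∘edge≗h w)))))
      π⇒neighbour : ∀ v w → (π v ==ᶠ w) ≡ true → sameBlockNeighbour g h v w ≡ true
      π⇒neighbour v w πv≡w with refl ← ==ᶠ⇒≡ πv≡w =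
        cong₂ _∧_ (≡⇒==ᶠ (trans (sym (κ∘edge≗h (π v))) (trans (cong κ (edge-π v)) (κ∘edge≗h v)))) (adj-π v)

    blockMatching⇒proper : BlockMatching g h π → isProper (downAdj g π) κ ≡ true
    blockMatching⇒proper bm = isProper⁺ {hadj = downAdj g π} {κ} λ i~j κi≡κj →
      let (i≢j , x , y , edge-x , edge-y , x~y) = downAdj⇒ i~j
          hy≡hx = trans (sym (κ∘edge≗h y)) (trans (cong κ edge-y) (trans (sym κi≡κj)
                   (trans (cong κ (sym edge-x)) (κ∘edge≗h x))))
          y≡πx = blockMatching-unique bm hy≡hx x~y
      in i≢j (trans (sym edge-x) (trans (sym (edge-π x)) (trans (cong edge (sym y≡πx)) edge-y)))

  edgeRep-lift : ∀ {L} {h : Fin n → Fin L} → BlockMatching g h π → h ∘ edgeRep ∘ edge ≗ h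
  edgeRep-lift {h = h} bm v with edgeRep-edge-either v
  ... | inj₁ rep≡v  = cong h rep≡v
  ... | inj₂ rep≡πv = trans (cong h rep≡πv) (blockMatching-sameBlock bm v)

  XsqCoeff-downAdj : ∀ α → XsqCoeff m (downAdj g π) α ≡
    count (λ h → hasBlockSizes (lookup α) h ∧ isBlockMatching g h π) (allFuns n (length α))
  XsqCoeff-downAdj α =
    count-bijection (_∘ edge) (λ h _ → h ∘ edgeRep) colouring⇒lift lift-determines lift⇒colouring
    where
    L : ℕ
    L = length α

    Colouring : (Fin m → Fin L) → Bool
    Colouring κ = isProper (downAdj g π) κ ∧ allᵇ (λ i → 2 * fiber κ i ≡ᵇ lookup α i) (allFin L)

    Lift : (Fin n → Fin L) → Bool
    Lift h = hasBlockSizes (lookup α) h ∧ isBlockMatching g h π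

    colouring⇒lift : ∀ κ h → Colouring κ ≡ true → κ ∘ edge ≗ h → Lift h ≡ true
    colouring⇒lift κ h colouring κ∘edge≗h = cong₂ _∧_
      (hasBlockSizes⁺ h λ i →
        trans (fiber-lift κ∘edge≗h i) (≡ᵇ-true⇒≡ (allᵇ-allFin⁻ (∧-true⁻ʳ colouring) i)))
      (isBlockMatching⁺ (proper⇒blockMatching κ∘edge≗h (∧-true⁻ˡ colouring)))

    lift-determines : ∀ κ h → Lift h ≡ true → Colouring κ ≡ true → κ ∘ edge ≗ h → κ ≗ h ∘ edgeRep
    lift-determines κ h _ _ κ∘edge≗h j = trans (cong κ (sym (edge-edgeRep j))) (κ∘edge≗h (edgeRep j))

    lift⇒colouring : ∀ κ h → Lift h ≡ true → κ ≗ h ∘ edgeRep → Colouring κ ≡ true × κ ∘ edge ≗ h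
    lift⇒colouring κ h lift κ≗ =
      cong₂ _∧_ (blockMatching⇒proper κ∘edge≗h bm) (allᵇ-allFin⁺ sizes) , κ∘edge≗h
      where
      bm : BlockMatching g h π
      bm = isBlockMatching⁻ (∧-true⁻ʳ {hasBlockSizes (lookup α) h} lift)
      κ∘edge≗h : κ ∘ edge ≗ h
      κ∘edge≗h v = trans (κ≗ (edge v)) (edgeRep-lift bm v)
      sizes : ∀ i → (2 * fiber κ i ≡ᵇ lookup α i) ≡ true
      sizes i = ≡⇒≡ᵇ-true (trans (sym (fiber-lift κ∘edge≗h i)) (hasBlockSizes⁻ {f = h} (∧-true⁻ˡ lift) i))

-- The right-hand side

matchingSideCoeff≡#matchingAssignments : ∀ {n} (g : Graph n) α →
  matchingSideCoeff g α ≡ #matchingAssignments g (lookup α)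
matchingSideCoeff≡#matchingAssignments {n} g α = begin
  ∑ˡ (filterᵇ (isPerfectMatching g) Π) X
    ≡⟨ ∑ˡ-filterᵇ (isPerfectMatching g) Π X ⟩
  ∑[ π ∈ Π ] ([ isPerfectMatching g π ] * X π)
    ≡⟨ ∑ˡ-cong Π (λ π → trans (colourings-as-lifts π) (count≡∑ˡ (R π) H)) ⟩
  ∑[ π ∈ Π ] ∑[ h ∈ H ] [ R π h ]
    ≡⟨ ∑ˡ-comm Π H (λ π h → [ R π h ]) ⟩
  ∑[ h ∈ H ] ∑[ π ∈ Π ] [ R π h ]
    ≡⟨ ∑ˡ-cong H block-matchings ⟩
  ∑[ h ∈ H ] [ sized h ∧ inducesMatchings g h ]
    ≡⟨ count≡∑ˡ (λ h → sized h ∧ inducesMatchings g h) H ⟨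
  #matchingAssignments g (lookup α) ∎
  where
  Π : List (Fin n → Fin n)
  Π = allFuns n n
  H : List (Fin n → Fin (length α))
  H = allFuns n (length α)

  X : (Fin n → Fin n) → ℕ
  X π = XsqCoeff (downSize π) (downAdj g π) α

  sized : (Fin n → Fin (length α)) → Bool
  sized = hasBlockSizes (lookup α)

  R : (Fin n → Fin n) → (Fin n → Fin (length α)) → Bool
  R π h = sized h ∧ isBlockMatching g h π

  colourings-as-lifts : ∀ π → [ isPerfectMatching g π ] * X π ≡ count (R π) H
  colourings-as-lifts π with isPerfectMatching g π in pm
  ... | true  = trans (+-identityʳ (X π)) (PerfectMatching.XsqCoeff-downAdj g pm α)
  ... | false = sym (count-none H λ h → ¬-not λ r → not-¬
                  (blockMatching-isPerfectMatching (isBlockMatching⁻ {g = g} {h} (∧-true⁻ʳ {sized h} r))) pm)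

  block-matchings : ∀ h → ∑[ π ∈ Π ] [ R π h ] ≡ [ sized h ∧ inducesMatchings g h ]
  block-matchings h = begin
    ∑[ π ∈ Π ] [ R π h ]
      ≡⟨ ∑ˡ-cong Π (λ π → [∧] (sized h) (isBlockMatching g h π)) ⟩
    ∑[ π ∈ Π ] ([ sized h ] * [ isBlockMatching g h π ])
      ≡⟨ *-distribˡ-∑ˡ Π [ sized h ] (λ π → [ isBlockMatching g h π ]) ⟨
    [ sized h ] * ∑[ π ∈ Π ] [ isBlockMatching g h π ]
      ≡⟨ cong ([ sized h ] *_) (count≡∑ˡ (isBlockMatching g h) Π) ⟨
    [ sized h ] * count (isBlockMatching g h) Π
      ≡⟨ cong ([ sized h ] *_) (count-blockMatchings g h) ⟩
    [ sized h ] * [ inducesMatchings g h ]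
      ≡⟨ [∧] (sized h) (inducesMatchings g h) ⟨
    [ sized h ∧ inducesMatchings g h ] ∎

proposition2p2 : (n : ℕ) → 2 ∣ n → (g : Graph n) →
    (α : List ℕ) → Ψcoeff g α ≡ matchingSideCoeff g α
proposition2p2 n _ g α = begin
  Ψcoeff g α                                          ≡⟨ Ψcoeff≡#matchingAssignments g α ⟩
  #matchingAssignments g (lookup (dropZeros α))       ≡⟨ #matchingAssignments-dropZeros g α ⟨
  #matchingAssignments g (lookup α)                   ≡⟨ matchingSideCoeff≡#matchingAssignments g α ⟨
  matchingSideCoeff g α                               ∎
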